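{- Assume the law of excluded middle. Let $\alpha\in\mathrm{ord}$ with $\alpha\ne\underline0$. Then either $\alpha=_{\mathrm{Ord}}\mathrm{suc}(\gamma)$ for some $\gamma\in\mathrm{ord}$ (i.e. $\alpha$ is an immediate successor), or $\alpha$ is the supremum of the ordinals $\gamma<\alpha$, i.e. for every $\beta\in\mathrm{ord}$, if $\gamma\le\beta$ for all $\gamma\in\mathrm{ord}$ with $\gamma<\alpha$, then $\alpha\le\beta$.
   Context: Let $\mathfrak F$ be a set of index sets containing $\mathbb N$ and every $\mathbb N_k=\{n\in\mathbb N:n<k\}$, closed (up to isomorphism) under finitely enumerated subsets, sets of finitely enumerated subsets, and disjoint unions indexed by elements of $\mathfrak F$. The set $\mathrm{ord}=\mathrm{ord}_{\mathfrak F}$ is defined inductively: a distinguished element $\underline 0$, and for every $I\in\mathfrak F$ and family $(\alpha_i)_{i\in I}$ in $\mathrm{ord}$ an element $\mathrm S(\alpha_i)_{i\in I}$. For $\alpha=\mathrm S(\alpha_i)_{i\in I}$, $\mathrm{In}_\alpha=I$; by convention $\mathrm{In}_{\underline0}=\emptyset$. For a finite list $F\subseteq_f\mathrm{In}_\alpha$, $\alpha_F$ is the list of the $\alpha_i$, $i\in F$. By simultaneous induction ($m\ge1$): $\alpha\le\beta^1,\dots,\beta^m$ means $\alpha_i<\beta^1,\dots,\beta^m$ for all $i\in\mathrm{In}_\alpha$; $\alpha<\beta^1,\dots,\beta^m$ means there exist finite lists $F_k\subseteq_f\mathrm{In}_{\beta^k}$, not all empty, with $\alpha\le\beta^1_{F_1},\dots,\beta^m_{F_m}$;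 $m=1$ gives binary $\le,<$. $\alpha=_{\mathrm{Ord}}\beta$ means $\alpha\le\beta$ and $\beta\le\alpha$. $\mathrm{suc}(\gamma)=\mathrm S(\beta_i)_{i\in\mathbb N_1}$ with $\beta_0=\gamma$. -}

module Defs where

open import Data.Nat using (ℕ)
open import Data.Fin using (Fin)
open import Data.List using (List; []; _∷_; _++_; map)
open import Data.List.Membership.Propositional using (_∈_)
open import Data.Product using (Σ; _×_; _,_; proj₁)
open import Data.Sum using (_⊎_)
open import Data.Unit using (⊤)
open import Data.Empty using (⊥)
open import Function using (_∘_)
open import Function.Bundles using (_↔_)
open import Relation.Binary.PropositionalEquality using (_≡_)
open import Relation.Nullary using (¬_)

-- A set 𝔉 of index sets, given as a universe of codes U with decoding El,
-- closed (up to isomorphism) under the operations required in the paper.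
record IndexSets : Set₁ where
  field
    U  : Set
    El : U → Set
    ℕ-code   : Σ U λ u → El u ↔ ℕ
    Fin-code : (k : ℕ) → Σ U λ u → El u ↔ Fin k
    sub-code : (u : U) (l : List (El u)) → Σ U λ v → El v ↔ Σ (El u) (λ x → x ∈ l)
    lists-code : (u : U) → Σ U λ v → El v ↔ List (El u)
    Σ-code : (u : U) (f : El u → U) → Σ U λ v → El v ↔ Σ (El u) (El ∘ f)

LEM : Set₁
LEM = (P : Set) → P ⊎ ¬ P

module OrdDefs (𝔉 : IndexSets) where
  open IndexSets 𝔉

  data Ord : Set where
    𝟎 : Ord
    S : (i : U) → (El i → Ord) → Ord

  In : Ord → Set
  In 𝟎 = ⊥
  In (S i f) = El i

  sub : (α : Ord) → In α → Ord
  sub 𝟎 ()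
  sub (S i f) j = f j

  Sel : List Ord → Set
  Sel [] = ⊤
  Sel (β ∷ βs) = List (In β) × Sel βs

  pick : (βs : List Ord) → Sel βs → List Ord
  pick [] _ = []
  pick (β ∷ βs) (F , Fs) = map (sub β) F ++ pick βs Fs

  AllEmpty : (βs : List Ord) → Sel βs → Set
  AllEmpty [] _ = ⊤
  AllEmpty (β ∷ βs) (F , Fs) = (F ≡ []) × AllEmpty βs Fs

  data _≤*_ : Ord → List Ord → Set
  data _<*_ : Ord → List Ord → Set

  data _≤*_ where
    ≤*-intro : ∀ {α βs} → ((i : In α) → sub α i <* βs) → α ≤* βs

  data _<*_ where
    <*-intro : ∀ {α βs} (Fs : Sel βs) → ¬ AllEmpty βs Fs → α ≤* pick βs Fs → α <* βs

  _≤_ : Ord → Ord → Set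
  α ≤ β = α ≤* (β ∷ [])

  _<_ : Ord → Ord → Set
  α < β = α <* (β ∷ [])

  _=Ord_ : Ord → Ord → Set
  α =Ord β = (α ≤ β) × (β ≤ α)

  osuc : Ord → Ord
  osuc γ = S (proj₁ (Fin-code 1)) (λ _ → γ)

{-# OPTIONS --safe #-}
-- Classically ≤ is total in the form α ≤ β ⊎ β < α. If α has a largest
-- immediate component αᵢ then α =Ord suc(αᵢ). Otherwise every αᵢ lies below
-- some αⱼ, so suc(αᵢ) < α; an upper bound β of all γ < α then bounds every
-- suc(αᵢ), whence αᵢ < β for all i, i.e. α ≤ β.
module Submission where

open import Defs
open import Axiom.DoubleNegationElimination using (DoubleNegationElimination; em⇒dne)
open import Axiom.ExcludedMiddle using (ExcludedMiddle)
open import Data.Empty using (⊥-elim)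
open import Data.Fin using (Fin)
open import Data.List using ([]; _∷_)
open import Data.Product using (Σ; ∃; _,_; proj₂)
open import Data.Sum using (_⊎_; inj₁; inj₂; [_,_])
open import Data.Unit using (tt)
open import Function.Bundles using (Inverse)
open import Level using (0ℓ)
open import Relation.Binary.PropositionalEquality using (_≡_)
open import Relation.Nullary using (¬_; yes; no)

LEM⇒dne : LEM → DoubleNegationElimination 0ℓ
LEM⇒dne lem = em⇒dne em
  where
  em : ExcludedMiddle 0ℓ
  em {P} = [ yes , no ] (lem P)

¬∀⇒∃¬ : LEM → {A : Set} {P : A → Set} → ¬ (∀ x → P x) → ∃ λ x → ¬ P x
¬∀⇒∃¬ lem ¬∀ = dne λ ¬∃ → ¬∀ λ x → dne λ ¬Px → ¬∃ (x , ¬Px)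
  where dne = LEM⇒dne lem

module _ (𝔉 : IndexSets) where
  open IndexSets 𝔉
  open OrdDefs 𝔉

  ≤-sub⇒< : ∀ {α β} (i : In β) → α ≤ sub β i → α < β
  ≤-sub⇒< i = <*-intro ((i ∷ []) , tt) λ { (() , _) }

  ≤-refl : (α : Ord) → α ≤ α
  ≤-refl 𝟎       = ≤*-intro λ ()
  ≤-refl (S u f) = ≤*-intro λ i → ≤-sub⇒< i (≤-refl (f i))

  sub-< : (α : Ord) (i : In α) → sub α i < α
  sub-< α i = ≤-sub⇒< i (≤-refl (sub α i))

  osuc-index : (γ : Ord) → In (osuc γ)
  osuc-index _ = Inverse.from (proj₂ (Fin-code 1)) Fin.zero

  ≤⇒<-osuc : ∀ {α γ} → α ≤ γ → α < osuc γ
  ≤⇒<-osuc {γ = γ} = ≤-sub⇒< (osuc-index γ)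

  <⇒osuc-≤ : ∀ {γ α} → γ < α → osuc γ ≤ α
  <⇒osuc-≤ γ<α = ≤*-intro λ _ → γ<α

  osuc-≤⇒< : ∀ {γ β} → osuc γ ≤ β → γ < β
  osuc-≤⇒< {γ} (≤*-intro h) = h (osuc-index γ)

  HasGreatestSub : Ord → Set
  HasGreatestSub α = Σ (In α) λ i → (j : In α) → sub α j ≤ sub α i

  greatestSub⇒=Ord-osuc : (α : Ord) ((i , _) : HasGreatestSub α) → α =Ord osuc (sub α i)
  greatestSub⇒=Ord-osuc α (i , greatest) =
    ≤*-intro (λ j → ≤⇒<-osuc (greatest j)) , <⇒osuc-≤ (sub-< α i)

  module _ (lem : LEM) where

    ≤-total : (α β : Ord) → α ≤ β ⊎ β < α
    ≤-total 𝟎       β = inj₁ (≤*-intro λ ())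
    ≤-total (S u f) β with lem (S u f ≤ β)
    ... | inj₁ α≤β = inj₁ α≤β
    ... | inj₂ α≰β with ¬∀⇒∃¬ lem (λ h → α≰β (≤*-intro h))
    ...   | i , fᵢ≮β = inj₂ (≤-sub⇒< i (≤*-intro βⱼ<fᵢ))
      where
      βⱼ<fᵢ : (j : In β) → sub β j < f i
      βⱼ<fᵢ j with ≤-total (f i) (sub β j)
      ... | inj₁ fᵢ≤βⱼ = ⊥-elim (fᵢ≮β (≤-sub⇒< j fᵢ≤βⱼ))
      ... | inj₂ βⱼ<fᵢ = βⱼ<fᵢ

    ≰⇒> : ∀ {α β} → ¬ α ≤ β → β < α
    ≰⇒> {α} {β} α≰β = [ (λ α≤β → ⊥-elim (α≰β α≤β)) , (λ β<α → β<α) ] (≤-total α β)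

    noGreatestSub⇒osuc-sub-< : (α : Ord) → ¬ HasGreatestSub α → (i : In α) → osuc (sub α i) < α
    noGreatestSub⇒osuc-sub-< α noGreatest i with ¬∀⇒∃¬ lem (λ h → noGreatest (i , h))
    ... | j , αⱼ≰αᵢ = ≤-sub⇒< j (<⇒osuc-≤ (≰⇒> αⱼ≰αᵢ))

    noGreatestSub⇒isSup : (α : Ord) → ¬ HasGreatestSub α →
      (β : Ord) → ((γ : Ord) → γ < α → γ ≤ β) → α ≤ β
    noGreatestSub⇒isSup α noGreatest β bound = ≤*-intro λ i →
      osuc-≤⇒< (bound (osuc (sub α i)) (noGreatestSub⇒osuc-sub-< α noGreatest i))

corollary3p20 : (𝔉 : IndexSets) → LEM → let open OrdDefs 𝔉 in
    (α : Ord) → ¬ (α ≡ 𝟎) →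
    (Σ Ord λ γ → α =Ord osuc γ)
    ⊎ ((β : Ord) → ((γ : Ord) → γ < α → γ ≤ β) → α ≤ β)
corollary3p20 𝔉 lem α _ with lem (HasGreatestSub 𝔉 α)
... | inj₁ greatest   = inj₁ (_ , greatestSub⇒=Ord-osuc 𝔉 α greatest)
... | inj₂ noGreatest = inj₂ (noGreatestSub⇒isSup 𝔉 lem α noGreatest)
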